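{- Let $p$ be a prime that is both a Brazilian prime and a Sophie Germain prime, and let $b,q$ be integers with $q\ge 2$, $1<b<p-1$ and $p=\frac{b^q-1}{b-1}$. Then $p\equiv q\equiv 2 \pmod 3$ and $b\equiv 1\pmod 3$.
   Context: A positive integer $n$ is Brazilian if there is an integer $b$ with $1<b<n-1$ such that all digits of the base-$b$ representation of $n$ are equal; equivalently $n = m\frac{b^q-1}{b-1}$ for some integers $1\le m<b$, $q\ge 2$ and $1<b<n-1$. A Brazilian prime is a Brazilian number that is prime (necessarily with $m=1$). A Sophie Germain prime is a prime $p$ such that $2p+1$ is also prime. -}

module Defs where

open import Data.Nat using (ℕ; _+_; _*_; _∸_; _^_; _≤_; _<_)
open import Data.Product using (Σ; _×_)
open import Data.Nat.Primality using (Prime)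
open import Relation.Binary.PropositionalEquality using (_≡_)

-- n = m (b^q - 1)/(b - 1), written division-free as n * (b - 1) = m * (b^q - 1)
Brazilian : ℕ → Set
Brazilian n = Σ ℕ λ b → Σ ℕ λ m → Σ ℕ λ q →
  (1 ≤ m) × (m < b) × (2 ≤ q) × (1 < b) × (b < n ∸ 1) ×
  (n * (b ∸ 1) ≡ m * (b ^ q ∸ 1))

BrazilianPrime : ℕ → Set
BrazilianPrime p = Brazilian p × Prime p

SophieGermainPrime : ℕ → Set
SophieGermainPrime p = Prime p × Prime (2 * p + 1)

{-# OPTIONS --safe #-}
-- p = 1 + b + ⋯ + b^(q-1).  Modulo 3 this repunit is 1 when b ≡ 0, it is
-- q when b ≡ 1, and it alternates 1, 0, 1, 0, … when b ≡ 2.  On the other hand a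
-- Sophie Germain prime p > 3 satisfies p ≡ 2 (mod 3), since p ≡ 1 would put 3 into
-- 2p + 1.  So b ≡ 1 is the only possibility, and then q ≡ p ≡ 2.
module Submission where

open import Defs
open import Data.Nat using (ℕ; zero; suc; _+_; _*_; _∸_; _^_; _≤_; _<_; _%_; s≤s; NonZero)
open import Data.Nat.Properties
open import Data.Nat.DivMod
open import Data.Nat.Divisibility using (m%n≡0⇒n∣m)
open import Data.Nat.Primality using (Prime; composite; prime⇒¬composite)
open import Data.Nat.Tactic.RingSolver using (solve-∀)
open import Data.Product using (_×_; _,_)
open import Data.Sum using (_⊎_; inj₁; inj₂)
open import Data.Empty using (⊥-elim)
open import Relation.Nullary using (contradiction)
open import Relation.Binary.PropositionalEquality
open ≡-Reasoning

repunit : ℕ → ℕ → ℕ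
repunit b zero    = 0
repunit b (suc n) = 1 + b * repunit b n

repunit[1+c,n]*c+1≡[1+c]^n : ∀ c n → repunit (suc c) n * c + 1 ≡ suc c ^ n
repunit[1+c,n]*c+1≡[1+c]^n c zero    = refl
repunit[1+c,n]*c+1≡[1+c]^n c (suc n) = begin
  (1 + suc c * r) * c + 1 ≡⟨ step c r ⟩
  suc c * (r * c + 1)     ≡⟨ cong (suc c *_) (repunit[1+c,n]*c+1≡[1+c]^n c n) ⟩
  suc c * suc c ^ n       ∎
  where
  r = repunit (suc c) n
  step : ∀ c r → (1 + suc c * r) * c + 1 ≡ suc c * (r * c + 1)
  step = solve-∀

n*[b∸1]≡b^q∸1⇒n≡repunit : ∀ n b q → 1 < b → n * (b ∸ 1) ≡ b ^ q ∸ 1 → n ≡ repunit b q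
n*[b∸1]≡b^q∸1⇒n≡repunit n (suc (suc c)) q (s≤s (s≤s _)) eq = *-cancelʳ-≡ n (repunit b q) (suc c) (begin
  n * suc c                   ≡⟨ eq ⟩
  b ^ q ∸ 1                   ≡⟨ cong (_∸ 1) (repunit[1+c,n]*c+1≡[1+c]^n (suc c) q) ⟨
  repunit b q * suc c + 1 ∸ 1 ≡⟨ m+n∸n≡m _ 1 ⟩
  repunit b q * suc c         ∎)
  where
  b = suc (suc c)

repunit[1,n]≡n : ∀ n → repunit 1 n ≡ n
repunit[1,n]≡n zero    = refl
repunit[1,n]≡n (suc n) = cong suc (trans (+-identityʳ _) (repunit[1,n]≡n n))

1+*-%-cong : ∀ {a a′ x x′} m .{{_ : NonZero m}} → a % m ≡ a′ % m → x % m ≡ x′ % m →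
             (1 + a * x) % m ≡ (1 + a′ * x′) % m
1+*-%-cong {a} {a′} {x} {x′} m a≡a′ x≡x′ = begin
  (1 + a * x) % m                       ≡⟨ %-distribˡ-+ 1 (a * x) m ⟩
  (1 % m + (a * x) % m) % m             ≡⟨ cong (λ v → (1 % m + v) % m) (%-distribˡ-* a x m) ⟩
  (1 % m + (a % m * (x % m)) % m) % m   ≡⟨ cong₂ (λ u v → (1 % m + (u * v) % m) % m) a≡a′ x≡x′ ⟩
  (1 % m + (a′ % m * (x′ % m)) % m) % m ≡⟨ cong (λ v → (1 % m + v) % m) (%-distribˡ-* a′ x′ m) ⟨
  (1 % m + (a′ * x′) % m) % m           ≡⟨ %-distribˡ-+ 1 (a′ * x′) m ⟨
  (1 + a′ * x′) % m                     ∎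

repunit-%-cong : ∀ m .{{_ : NonZero m}} b c n → b % m ≡ c % m →
                 repunit b n % m ≡ repunit c n % m
repunit-%-cong m b c zero    b≡c = refl
repunit-%-cong m b c (suc n) b≡c = 1+*-%-cong m b≡c (repunit-%-cong m b c n b≡c)

repunit[2,n]%3≡n%2 : ∀ n → repunit 2 n % 3 ≡ n % 2
repunit[2,n]%3≡n%2 zero          = refl
repunit[2,n]%3≡n%2 (suc zero)    = refl
repunit[2,n]%3≡n%2 (suc (suc n)) = begin
  (1 + 2 * (1 + 2 * r)) % 3 ≡⟨ cong (_% 3) (two-steps r) ⟩
  (r + (1 + r) * 3) % 3     ≡⟨ [m+kn]%n≡m%n r (1 + r) 3 ⟩
  r % 3                     ≡⟨ repunit[2,n]%3≡n%2 n ⟩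
  n % 2                     ∎
  where
  r = repunit 2 n
  two-steps : ∀ r → 1 + 2 * (1 + 2 * r) ≡ r + (1 + r) * 3
  two-steps = solve-∀

%3-cases : ∀ n → n % 3 ≡ 0 ⊎ n % 3 ≡ 1 ⊎ n % 3 ≡ 2
%3-cases n with n % 3 | m%n<n n 3
... | 0 | _ = inj₁ refl
... | 1 | _ = inj₂ (inj₁ refl)
... | 2 | _ = inj₂ (inj₂ refl)
... | suc (suc (suc _)) | s≤s (s≤s (s≤s ()))

repunit%3≡2⇒n%3≡2∧b%3≡1 : ∀ b n → 1 ≤ n → repunit b n % 3 ≡ 2 → n % 3 ≡ 2 × b % 3 ≡ 1
repunit%3≡2⇒n%3≡2∧b%3≡1 b n@(suc _) (s≤s _) r≡2 with %3-cases b
... | inj₁ b≡0        = contradiction (trans (sym r≡2) (repunit-%-cong 3 b 0 n b≡0)) λ ()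
... | inj₂ (inj₁ b≡1) = n%3≡2 , b≡1
  where
  n%3≡2 : n % 3 ≡ 2
  n%3≡2 = begin
    n % 3           ≡⟨ cong (_% 3) (repunit[1,n]≡n n) ⟨
    repunit 1 n % 3 ≡⟨ repunit-%-cong 3 b 1 n b≡1 ⟨
    repunit b n % 3 ≡⟨ r≡2 ⟩
    2               ∎
... | inj₂ (inj₂ b≡2) = ⊥-elim (<⇒≢ (m%n<n n 2) (begin
  n % 2           ≡⟨ repunit[2,n]%3≡n%2 n ⟨
  repunit 2 n % 3 ≡⟨ repunit-%-cong 3 b 2 n b≡2 ⟨
  repunit b n % 3 ≡⟨ r≡2 ⟩
  2               ∎))

sophieGermain%3≡2 : ∀ p → 3 < p → Prime p → Prime (2 * p + 1) → p % 3 ≡ 2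
sophieGermain%3≡2 p 3<p p-prime 2p+1-prime with %3-cases p
... | inj₁ p≡0        = ⊥-elim (prime⇒¬composite p-prime (composite 3<p (m%n≡0⇒n∣m p 3 p≡0)))
... | inj₂ (inj₁ p≡1) = ⊥-elim (prime⇒¬composite 2p+1-prime
                          (composite 3<2p+1 (m%n≡0⇒n∣m (2 * p + 1) 3 3∣2p+1)))
  where
  3<2p+1 : 3 < 2 * p + 1
  3<2p+1 = ≤-trans 3<p (≤-trans (m≤m+n p (p + 0)) (m≤m+n (2 * p) 1))
  3∣2p+1 : (2 * p + 1) % 3 ≡ 0
  3∣2p+1 = trans (cong (_% 3) (+-comm (2 * p) 1)) (1+*-%-cong {2} {2} {p} {1} 3 refl p≡1)
... | inj₂ (inj₂ p≡2) = p≡2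

lemma4 : (p b q : ℕ) → BrazilianPrime p → SophieGermainPrime p →
    2 ≤ q → 1 < b → b < p ∸ 1 → p * (b ∸ 1) ≡ b ^ q ∸ 1 →
    (p % 3 ≡ 2) × (q % 3 ≡ 2) × (b % 3 ≡ 1)
lemma4 zero _ _ _ _ _ _ () _
lemma4 p@(suc _) b q _ (p-prime , 2p+1-prime) 2≤q 1<b b<p-1 eq =
  p%3≡2 , repunit%3≡2⇒n%3≡2∧b%3≡1 b q 1≤q repunit%3≡2
  where
  1≤q : 1 ≤ q
  1≤q = ≤-trans (n≤1+n 1) 2≤q
  3<p : 3 < p
  3<p = s≤s (≤-<-trans 1<b b<p-1)
  p%3≡2 : p % 3 ≡ 2
  p%3≡2 = sophieGermain%3≡2 p 3<p p-prime 2p+1-prime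
  repunit%3≡2 : repunit b q % 3 ≡ 2
  repunit%3≡2 = trans (cong (_% 3) (sym (n*[b∸1]≡b^q∸1⇒n≡repunit p b q 1<b eq))) p%3≡2
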